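{- Let $R$ be a set of requests on a bidirected tree $T$ in which every pair of opposite arcs contains the emission arc or the reception arc of some request of $R$, and let $W$ be a clique of $\mathcal{I}(R,T)$. Then there exist a bough $Q_W$ of $T$ and a vertex $x_W\in V(Q_W)$ such that every request of $W$ sharing no arc with $Q_W$ is unimodal in $T[x_W]$. Moreover, these pairs can be chosen so that the set of pairs $(Q_W,x_W)$, taken over all cliques $W$ of $\mathcal{I}(R,T)$, has size $O(|R|^2)$.
   Context: A bidirected tree $T$ is a digraph obtained from a finite undirected tree by replacing each edge $uv$ by the two arcs $(u,v)$ and $(v,u)$. A request in $T$ is a directed path in $T$ with at least one arc. For a directed path $r$, $s_r$ is its first vertex, $t_r$ its last vertex, $s_r^+$ its second vertex, $t_r^-$ its penultimate vertex; its emission arc is $(s_r,s_r^+)$ and its reception arc is $(t_r^-,t_r)$. $T[x,y]$ denotes the unique directed path from $x$ to $y$ in $T$. A request $r$ interferes on $r'$ if $T[s_r,t_{r'}]$ has first arc the emission arc of $r$ and last arc the reception arc of $r'$; two requests interfere if one interferes on the other. The interference graph $\mathcal{I}(R,T)$ has vertex set $R$ and an edge between two distinct requests iff they interfere. $T[x]$ denotes $T$ rooted at $x$. In a rooted tree, an arc is converging if directed towards the root and diverging otherwise; a directed path is converging (resp. diverging) if all its arcs are converging (resp. diverging), and unimodal otherwise. A bough of $T$ is the bidirected path (both arc directions) between two leaves of $T$. -}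

module Defs where

open import Data.Nat using (ℕ; _≤_; _*_; _^_; suc)
open import Data.Fin using (Fin)
open import Data.Bool using (Bool; true; false)
open import Data.Maybe using (Maybe; just; nothing)
open import Data.List using (List; []; _∷_; head; last; length)
open import Data.List.Membership.Propositional using (_∈_; _∉_)
open import Data.List.Relation.Unary.All using (All)
open import Data.List.Relation.Unary.Linked using (Linked)
open import Data.List.Relation.Unary.Unique.Propositional using (Unique)
open import Data.Product using (Σ; ∃; ∃-syntax; _×_; _,_)
open import Data.Sum using (_⊎_)
open import Relation.Nullary using (¬_)
open import Relation.Binary.PropositionalEquality using (_≡_; _≢_)

-- Its bidirected version has the arc (u,v)
-- whenever uv is an edge.

IsPathIn : {n : ℕ} → (Fin n → Fin n → Bool) → List (Fin n) → Set
IsPathIn adj P = Linked (λ u v → adj u v ≡ true) P × Unique P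

record Tree : Set where
  field
    n         : ℕ
    adj       : Fin n → Fin n → Bool
    adj-sym   : ∀ u v → adj u v ≡ adj v u
    adj-irr   : ∀ u → adj u u ≡ false
    path-exists : ∀ u v → ∃[ P ] (IsPathIn adj P × head P ≡ just u × last P ≡ just v)
    path-unique : ∀ u v (P P' : List (Fin n)) →
                  IsPathIn adj P → head P ≡ just u → last P ≡ just v →
                  IsPathIn adj P' → head P' ≡ just u → last P' ≡ just v →
                  P ≡ P'

module _ (T : Tree) where
  open Tree T

  V : Set
  V = Fin n

  Arc : Set
  Arc = V × V

  IsPath : List V → Set
  IsPath = IsPathIn adj

  arcs : List V → List Arc
  arcs []           = []
  arcs (x ∷ [])     = []
  arcs (x ∷ y ∷ xs) = (x , y) ∷ arcs (y ∷ xs)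

  IsRequest : List V → Set
  IsRequest r = IsPath r × (2 ≤ length r)

  emission : List V → Maybe Arc
  emission r = head (arcs r)

  reception : List V → Maybe Arc
  reception r = last (arcs r)

  -- r interferes on r' : the path T[s_r, t_r'] has first arc the
  -- emission arc of r and last arc the reception arc of r'.
  -- (T[s_r,t_r'] is the unique path with these endpoints; a path whose
  -- first arc is emission r and last arc is reception r' is such a path.)
  InterferesOn : List V → List V → Set
  InterferesOn r r' =
    ∃[ P ] (IsPath P × head (arcs P) ≡ emission r × last (arcs P) ≡ reception r')

  Interfere : List V → List V → Set
  Interfere r r' = InterferesOn r r' ⊎ InterferesOn r' r

  IsClique : List (List V) → List (List V) → Set
  IsClique R W = All (_∈ R) W ×
    (∀ r r' → r ∈ W → r' ∈ W → r ≢ r' → Interfere r r')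

  Covered : List (List V) → Set
  Covered R = ∀ u v → adj u v ≡ true →
    ∃[ r ] (r ∈ R × (emission r ≡ just (u , v) ⊎ emission r ≡ just (v , u)
                     ⊎ reception r ≡ just (u , v) ⊎ reception r ≡ just (v , u)))

  IsLeaf : V → Set
  IsLeaf v = ∃[ u ] (adj v u ≡ true × (∀ w → adj v w ≡ true → w ≡ u))

  IsBough : List V → Set
  IsBough Q = IsPath Q × ∃[ a ] ∃[ b ] (head Q ≡ just a × last Q ≡ just b
                × a ≢ b × IsLeaf a × IsLeaf b)

  -- the request r shares no arc with the bough Q (Q contains both
  -- directions of each of its edges)
  SharesNoArc : List V → List V → Set
  SharesNoArc r Q = ∀ u v → (u , v) ∈ arcs r →
    (u , v) ∉ arcs Q × (v , u) ∉ arcs Q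

  -- in T[x], the arc (u,v) is converging (directed towards the root x)
  -- iff the path T[u,x] starts with the arc (u,v); diverging otherwise
  Converging : V → Arc → Set
  Converging x a = ∃[ P ] (IsPath P × head (arcs P) ≡ just a × last P ≡ just x)

  Diverging : V → Arc → Set
  Diverging x a = ¬ Converging x a

  Unimodal : V → List V → Set
  Unimodal x r = ¬ All (Converging x) (arcs r) × ¬ All (Diverging x) (arcs r)

module Submission where

-- For an arc α of T, the shore of α is the set of roots x for which α is converging in T[x].
-- Collect, for a clique W, the emission arcs and the reversed reception arcs of its requests.
-- Two emission shores meet (both contain the target of the request interfered on) and two
-- reversed reception shores meet (both contain the source of the interfering request), so
-- among any three arcs of the family two shores meet.  Shores of two edges that meet are
-- nested or cover T together; taking shore-minimal arcs of the family therefore yields two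
-- distinct leaves a and b such that every shore of the family contains a or b.  A shore
-- containing a whose edge is not on the bough Q from a to b also contains b, so for a
-- request sharing no arc with Q both its emission arc and its reversed reception arc are
-- converging in T[b], and the request is unimodal there.  By the covering hypothesis every
-- leaf is an end of an emission or reception arc, so a and b range over at most 4|R|
-- vertices, which bounds the number of pairs (Q , b) by 16|R|².

open import Defs
open import Level using (0ℓ)
open import Function using (_∘_; id)
open import Data.Nat using (zero; suc; z≤n; s≤s; z<s; _≤_; _<_; _*_; _^_; _+_; _≤?_)
open import Data.Nat.Properties using (module ≤-Reasoning; ≤-refl; ≰⇒>; <-≤-trans; +-suc; m<m+n; +-mono-≤; *-mono-≤; *-suc; <-irrefl)
open import Data.Nat.Tactic.RingSolver using (solve-∀)
open import Data.Fin using (Fin)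
import Data.Fin as Fin
open import Data.Fin.Properties using (any?; all?; pigeonhole; <⇒≢) renaming (_≟_ to _≟ᶠ_)
open import Data.Bool using (true)
import Data.Bool.Properties as Bool
open import Data.Maybe using (Maybe; just; nothing)
import Data.Maybe as Maybe
open import Data.Maybe.Properties using (just-injective)
open import Data.Maybe.Relation.Binary.Connected using (Connected)
import Data.Maybe.Relation.Binary.Connected as Connected
open import Data.List using (List; []; _∷_; _++_; [_]; head; last; length; map; filter; lookup; concatMap; cartesianProductWith; fromMaybe)
open import Data.List.Properties using (length-++; length-map; ∷-injectiveʳ)
import Data.List.Properties as List
open import Data.List.Membership.Propositional using (_∈_; _∉_; find; lose)
open import Data.List.Membership.Propositional.Properties using (∈-∃++; ∈-filter⁺; ∈-filter⁻; ∈-lookup; ∈-++⁺ˡ; ∈-++⁺ʳ; ∈-++⁻; ∈-concatMap⁺; ∈-concatMap⁻; ∈-cartesianProductWith⁺)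
open import Data.List.Relation.Unary.Any using (here; there)
open import Data.List.Relation.Unary.All as All using (All; []; _∷_)
open import Data.List.Relation.Unary.All.Properties using (¬Any⇒All¬; ¬All⇒Any¬; ++⁻; ++⁺)
open import Data.List.Relation.Unary.AllPairs using ([]; _∷_)
open import Data.List.Relation.Unary.Linked as Linked using (Linked; []; [-]; _∷_)
import Data.List.Relation.Unary.Linked.Properties as Linkedₚ
open import Data.List.Relation.Unary.Unique.Propositional using (Unique)
import Data.List.Relation.Unary.Unique.Propositional.Properties as Unique
open import Data.Product using (∃-syntax; _×_; _,_; proj₁; proj₂; swap)
import Data.Product.Properties as Product
open import Data.Sum using (_⊎_; inj₁; inj₂; [_,_]′)
import Data.Sum as Sum
open import Data.Empty using (⊥; ⊥-elim)
open import Relation.Nullary using (¬_; Dec; yes; no; contradiction)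
open import Relation.Nullary.Decidable using (_×-dec_; _→-dec_; ¬?; map′; decidable-stable)
open import Relation.Unary using (Pred; _⊆_; _≬_; ∁)
open import Relation.Unary.Properties using (≬-sym)
import Relation.Unary
open import Relation.Binary using (Rel; Transitive; Decidable)
open import Relation.Binary.PropositionalEquality using (_≡_; _≢_; refl; sym; trans; cong; cong₂; subst; module ≡-Reasoning)

head-∈ : ∀ {A : Set} {xs : List A} {x} → head xs ≡ just x → x ∈ xs
head-∈ {xs = _ ∷ _} refl = here refl

last-∈ : ∀ {A : Set} {xs : List A} {x} → last xs ≡ just x → x ∈ xs
last-∈ {xs = _ ∷ []}     refl = here refl
last-∈ {xs = _ ∷ _ ∷ _} eq   = there (last-∈ eq)

last-++-[] : ∀ {A : Set} (xs : List A) y → last (xs ++ [ y ]) ≡ just y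
last-++-[] []           y = refl
last-++-[] (_ ∷ [])     y = refl
last-++-[] (_ ∷ x ∷ xs) y = last-++-[] (x ∷ xs) y

∈-fromMaybe⁺ : ∀ {A : Set} {m : Maybe A} {x} → m ≡ just x → x ∈ fromMaybe m
∈-fromMaybe⁺ refl = here refl

∈-fromMaybe⁻ : ∀ {A : Set} {m : Maybe A} {x} → x ∈ fromMaybe m → m ≡ just x
∈-fromMaybe⁻ {m = just _} (here refl) = refl

map-swap-just⁻ : ∀ {A B : Set} {m : Maybe (A × B)} {p} → Maybe.map swap m ≡ just p → m ≡ just (swap p)
map-swap-just⁻ {m = just _} refl = refl

lookup-injective : ∀ {A : Set} {xs : List A} → Unique xs → ∀ i j → lookup xs i ≡ lookup xs j → i ≡ j
lookup-injective (_ ∷ _)  Fin.zero    Fin.zero    _  = refl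
lookup-injective (x∉ ∷ _) Fin.zero    (Fin.suc j) eq = contradiction eq (All.lookup x∉ (∈-lookup j))
lookup-injective (x∉ ∷ _) (Fin.suc i) Fin.zero    eq = contradiction (sym eq) (All.lookup x∉ (∈-lookup i))
lookup-injective (_ ∷ u)  (Fin.suc i) (Fin.suc j) eq = cong Fin.suc (lookup-injective u i j eq)

unique-length≤ : ∀ {n} {xs : List (Fin n)} → Unique xs → length xs ≤ n
unique-length≤ {n} {xs} u with length xs ≤? n
... | yes ≤n = ≤n
... | no ≰n with i , j , i<j , eq ← pigeonhole (≰⇒> ≰n) (lookup xs) =
  contradiction (lookup-injective u i j eq) (<⇒≢ i<j)

length-cartesianProductWith : ∀ {A B C : Set} (f : A → B → C) xs ys →
  length (cartesianProductWith f xs ys) ≡ length xs * length ys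
length-cartesianProductWith f []       ys = refl
length-cartesianProductWith f (x ∷ xs) ys = begin
  length (map (f x) ys ++ cartesianProductWith f xs ys)        ≡⟨ length-++ (map (f x) ys) ⟩
  length (map (f x) ys) + length (cartesianProductWith f xs ys) ≡⟨ cong₂ _+_ (length-map (f x) ys) (length-cartesianProductWith f xs ys) ⟩
  length ys + length xs * length ys                             ∎
  where open ≡-Reasoning

length-concatMap≤ : ∀ {A B : Set} {k} (f : A → List B) → (∀ x → length (f x) ≤ k) →
  ∀ xs → length (concatMap f xs) ≤ k * length xs
length-concatMap≤ f bound [] = z≤n
length-concatMap≤ {k = k} f bound (x ∷ xs) = begin
  length (f x ++ concatMap f xs)        ≡⟨ length-++ (f x) ⟩
  length (f x) + length (concatMap f xs) ≤⟨ +-mono-≤ (bound x) (length-concatMap≤ f bound xs) ⟩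
  k + k * length xs                      ≡⟨ *-suc k (length xs) ⟨
  k * length (x ∷ xs)                    ∎
  where open ≤-Reasoning

module _ {A : Set} (_≼_ : Rel A 0ℓ) where

  Minimal : List A → A → Set
  Minimal xs m = ∀ {y} → y ∈ xs → y ≼ m → m ≼ y

module _ {A : Set} {_≼_ : Rel A 0ℓ} (≼-trans : Transitive _≼_) (_≼?_ : Decidable _≼_) where

  minimal-∈ : ∀ {x} xs → x ∈ xs → ∃[ m ] (m ∈ xs × Minimal _≼_ xs m)
  minimal-∈ (y ∷ []) _ = y , here refl , λ { (here refl) y≼y → y≼y }
  minimal-∈ (y ∷ ys@(_ ∷ _)) _ with minimal-∈ ys (here refl)
  ... | m , m∈ , m-min with y ≼? m
  ...   | yes y≼m = y , here refl , λ
          { (here refl) y≼y → y≼y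
          ; (there z∈) z≼y → ≼-trans y≼m (m-min z∈ (≼-trans z≼y y≼m)) }
  ...   | no y⋠m = m , there m∈ , λ
          { (here refl) y≼m → contradiction y≼m y⋠m
          ; (there z∈) → m-min z∈ }

two-kinds-pigeonhole : ∀ {A : Set} {P Q : A → Set} {_~_ : A → A → Set} →
  (∀ {x y} → P x → P y → x ~ y) → (∀ {x y} → Q x → Q y → x ~ y) →
  ∀ {x y z} → P x ⊎ Q x → P y ⊎ Q y → P z ⊎ Q z → x ~ y ⊎ y ~ z ⊎ x ~ z
two-kinds-pigeonhole p q (inj₁ px) (inj₁ py) _         = inj₁ (p px py)
two-kinds-pigeonhole p q (inj₂ qx) (inj₂ qy) _         = inj₁ (q qx qy)
two-kinds-pigeonhole p q (inj₁ px) (inj₂ qy) (inj₁ pz) = inj₂ (inj₂ (p px pz))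
two-kinds-pigeonhole p q (inj₁ px) (inj₂ qy) (inj₂ qz) = inj₂ (inj₁ (q qy qz))
two-kinds-pigeonhole p q (inj₂ qx) (inj₁ py) (inj₁ pz) = inj₂ (inj₁ (p py pz))
two-kinds-pigeonhole p q (inj₂ qx) (inj₁ py) (inj₂ qz) = inj₂ (inj₂ (q qx qz))

module _ (T : Tree) where
  open Tree T
  open import Data.List.Membership.DecPropositional (_≟ᶠ_ {n}) using (_∈?_)

  Adj : V T → V T → Set
  Adj u v = adj u v ≡ true

  IsEdge : Arc T → Set
  IsEdge α = Adj (proj₁ α) (proj₂ α)

  Path : List (V T) → Set
  Path = IsPath T

  adj-sym′ : ∀ {u v} → Adj u v → Adj v u
  adj-sym′ {u} {v} = trans (adj-sym v u)

  adj⇒≢ : ∀ {u v} → Adj u v → u ≢ v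
  adj⇒≢ {u} uu refl = contradiction (trans (sym uu) (adj-irr u)) λ ()

  edge-path : ∀ {u v} → Adj u v → Path (u ∷ v ∷ [])
  edge-path uv = uv ∷ [-] , (adj⇒≢ uv ∷ []) ∷ [] ∷ []

  path-tail : ∀ {x xs} → Path (x ∷ xs) → Path xs
  path-tail (l , _ ∷ u) = Linked.tail l , u

  path-head-∉ : ∀ {x xs} → Path (x ∷ xs) → x ∉ xs
  path-head-∉ (_ , x∉ ∷ _) x∈ = All.lookup x∉ x∈ refl

  path-∷ : ∀ {x y ys} → Adj x y → x ∉ y ∷ ys → Path (y ∷ ys) → Path (x ∷ y ∷ ys)
  path-∷ xy x∉ (l , u) = xy ∷ l , ¬Any⇒All¬ _ x∉ ∷ u

  path-∷ʳ : ∀ {xs x y} → Path xs → last xs ≡ just x → Adj x y → y ∉ xs → Path (xs ++ [ y ])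
  path-∷ʳ {y = y} (l , u) lx xy y∉ =
    Linkedₚ.++⁺ l (subst (λ m → Connected Adj m (just y)) (sym lx) (Connected.just xy)) [-] ,
    Unique.++⁺ u ([] ∷ []) (λ { (y∈ , here refl) → y∉ y∈ })

  path-prefix : ∀ xs {y ys} → Path (xs ++ y ∷ ys) → Path (xs ++ [ y ])
  path-prefix []            _                 = [-] , [] ∷ []
  path-prefix (x ∷ [])      (xy ∷ _ , x∉ ∷ _) = xy ∷ [-] , (All.head x∉ ∷ []) ∷ [] ∷ []
  path-prefix (x ∷ x′ ∷ xs) (xx′ ∷ l , x∉ ∷ u) with l′ , u′ ← path-prefix (x′ ∷ xs) (l , u) =
    xx′ ∷ l′ , ++⁺ (proj₁ x∉′) (All.head (proj₂ x∉′) ∷ []) ∷ u′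
    where x∉′ = ++⁻ (x′ ∷ xs) x∉

  pathBetween : V T → V T → List (V T)
  pathBetween u v = proj₁ (path-exists u v)

  pathBetween-isPath : ∀ u v → Path (pathBetween u v)
  pathBetween-isPath u v = proj₁ (proj₂ (path-exists u v))

  head-pathBetween : ∀ u v → head (pathBetween u v) ≡ just u
  head-pathBetween u v = proj₁ (proj₂ (proj₂ (path-exists u v)))

  last-pathBetween : ∀ u v → last (pathBetween u v) ≡ just v
  last-pathBetween u v = proj₂ (proj₂ (proj₂ (path-exists u v)))

  path-from : ∀ u x → ∃[ rest ] (Path (u ∷ rest) × last (u ∷ rest) ≡ just x)
  path-from u x with path-exists u x
  ... | _ ∷ rest , p , refl , l = rest , p , l

  path-from-unique : ∀ {u x rest rest′} → Path (u ∷ rest) → last (u ∷ rest) ≡ just x →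
                     Path (u ∷ rest′) → last (u ∷ rest′) ≡ just x → rest ≡ rest′
  path-from-unique {u} {x} p l p′ l′ = ∷-injectiveʳ (path-unique u x _ _ p refl l p′ refl l′)

  arcs-head : ∀ {xs a b} → head (arcs T xs) ≡ just (a , b) → head xs ≡ just a
  arcs-head {_ ∷ _ ∷ _} refl = refl

  arcs-last : ∀ xs {a b} → last (arcs T xs) ≡ just (a , b) → last xs ≡ just b
  arcs-last (_ ∷ _ ∷ [])     refl = refl
  arcs-last (_ ∷ y ∷ z ∷ zs) eq   = arcs-last (y ∷ z ∷ zs) eq

  arcs-edge : ∀ {xs α} → Linked Adj xs → α ∈ arcs T xs → IsEdge α
  arcs-edge (xy ∷ _) (here refl) = xy
  arcs-edge (_ ∷ l)  (there α∈)  = arcs-edge l α∈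

  arcs-∈ : ∀ {xs a b} → (a , b) ∈ arcs T xs → a ∈ xs
  arcs-∈ {_ ∷ _ ∷ _} (here refl) = here refl
  arcs-∈ {_ ∷ _ ∷ _} (there a∈)  = there (arcs-∈ a∈)

  -- Shore (u , v) is the component of T − uv containing v.
  Shore : Arc T → Pred (V T) 0ℓ
  Shore α x = Converging T x α

  shore-path : ∀ {u v x} → Shore (u , v) x → ∃[ r ] (Path (u ∷ v ∷ r) × last (v ∷ r) ≡ just x)
  shore-path (_ ∷ _ ∷ r , p , refl , l) = r , p , l

  shore-head : ∀ {u v x rest} → Shore (u , v) x → Path (u ∷ rest) → last (u ∷ rest) ≡ just x →
               head rest ≡ just v
  shore-head c p l with _ , p′ , l′ ← shore-path c = cong head (path-from-unique p l p′ l′)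

  shore-neighbour : ∀ {u v w} → Adj u v → Shore (u , w) v → w ≡ v
  shore-neighbour uv c = sym (just-injective (shore-head c (edge-path uv) refl))

  shore-disjoint : ∀ {α x} → Shore α x → Shore (swap α) x → ⊥
  shore-disjoint {u , v} c c′ with _ , p , l ← shore-path c =
    path-head-∉ p (there (head-∈ (shore-head c′ (path-tail p) l)))

  shore-prefix : ∀ {a b x} r → Path (a ∷ b ∷ r) → x ∈ b ∷ r → Shore (a , b) x
  shore-prefix {a} _ p x∈ with ∈-∃++ x∈
  ... | []     , _ , refl = _ , path-prefix (a ∷ []) p , refl , refl
  ... | _ ∷ ys , _ , refl = _ , path-prefix (a ∷ _ ∷ ys) p , refl , last-++-[] (a ∷ _ ∷ ys) _

  neighbour-on-path : ∀ {u v x rest} → Adj u v → Path (u ∷ rest) → last (u ∷ rest) ≡ just x →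
                      v ∈ rest → Shore (u , v) x
  neighbour-on-path {rest = _ ∷ r} uv p l v∈ with refl ← shore-neighbour uv (shore-prefix r p v∈) =
    _ , p , refl , l

  shore-step : ∀ {α q q′} → Adj q q′ → Shore α q → (q′ , q) ≢ α → Shore α q′
  shore-step {u , v} {q} {q′} qq′ c q′q≢α with r , p , l ← shore-path c | q′ ∈? (u ∷ v ∷ r)
  ... | no q′∉             = _ , path-∷ʳ p l qq′ q′∉ , refl , last-++-[] (u ∷ v ∷ r) q′
  ... | yes (here refl)    = contradiction (cong (q′ ,_) (sym (shore-neighbour (adj-sym′ qq′) c))) q′q≢α
  ... | yes (there q′∈)    = shore-prefix r p q′∈

  shore-total : ∀ {u v} → Adj u v → ∀ x → Shore (u , v) x ⊎ Shore (v , u) x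
  shore-total {u} {v} uv x with rest , p , l ← path-from u x | v ∈? rest
  ... | yes v∈ = inj₁ (neighbour-on-path uv p l v∈)
  ... | no v∉  = inj₂ (_ , path-∷ (adj-sym′ uv) v∉u∷rest p , refl , l)
    where
      v∉u∷rest : v ∉ u ∷ rest
      v∉u∷rest (here v≡u) = adj⇒≢ uv (sym v≡u)
      v∉u∷rest (there v∈) = v∉ v∈

  shore-complement : ∀ {α} → IsEdge α → ∁ (Shore α) ⊆ Shore (swap α)
  shore-complement {u , v} uv {x} ¬c with shore-total uv x
  ... | inj₁ c = contradiction c ¬c
  ... | inj₂ c = c

  shore? : ∀ α → Relation.Unary.Decidable (Shore α)
  shore? (u , v) x with path-from u x
  ... | []    , p , l = no λ c → contradiction (shore-head c p l) λ ()
  ... | b ∷ _ , p , l with b ≟ᶠ v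
  ...   | yes refl = yes (_ , p , refl , l)
  ...   | no b≢v   = no λ c → b≢v (just-injective (shore-head c p l))

  shore-along : ∀ {α xs a b} → Linked Adj xs → head xs ≡ just a → last xs ≡ just b →
                swap α ∉ arcs T xs → Shore α a → Shore α b
  shore-along {xs = []}        _        ()   _  _  _
  shore-along {xs = _ ∷ []}    _        refl refl _  c = c
  shore-along {xs = _ ∷ _ ∷ _} (xy ∷ l) refl lb ᾱ∉ c =
    shore-along l refl lb (ᾱ∉ ∘ there) (shore-step xy c λ eq → ᾱ∉ (here (cong swap (sym eq))))

  shore-∋-path-start : ∀ {xs s ρ} → Path xs → head xs ≡ just s → last (arcs T xs) ≡ just ρ →
                       Shore (swap ρ) s
  shore-∋-path-start {_ ∷ _ ∷ []} (xy ∷ _ , _) refl refl = _ , edge-path (adj-sym′ xy) , refl , refl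
  shore-∋-path-start {x ∷ y ∷ z ∷ zs} p refl lρ =
    shore-step (adj-sym′ (Linked.head (proj₁ p))) (shore-∋-path-start (path-tail p) refl lρ)
      λ { refl → path-head-∉ p (last-∈ (arcs-last (y ∷ z ∷ zs) lρ)) }

  shore-⊆ : ∀ {u v w z} → Shore (u , v) z → ¬ Shore (w , z) v → Shore (w , z) ⊆ Shore (u , v)
  shore-⊆ cz ¬cv cy with r , p , l ← shore-path cy =
    shore-along (Linked.tail (proj₁ p)) refl l (λ vu∈ → ¬cv (shore-prefix r p (arcs-∈ vu∈))) cz

  _⊑_ : Rel (Arc T) 0ℓ
  α ⊑ β = Shore α ⊆ Shore β

  ⊑-trans : Transitive _⊑_
  ⊑-trans α⊑β β⊑γ = β⊑γ ∘ α⊑β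

  _⊑?_ : Decidable _⊑_
  α ⊑? β = map′ (λ f {x} → f x) (λ f x → f) (all? λ x → shore? α x →-dec shore? β x)

  _≬?_ : ∀ α β → Dec (Shore α ≬ Shore β)
  α ≬? β = any? λ x → shore? α x ×-dec shore? β x

  meeting-shores : ∀ {α β} → IsEdge α → IsEdge β → Shore α ≬ Shore β →
                   α ⊑ β ⊎ β ⊑ α ⊎ ∁ (Shore α) ⊆ Shore β
  meeting-shores {u , v} {w , z} uv wz meet
    with Product.≡-dec _≟ᶠ_ _≟ᶠ_ (w , z) (u , v) | Product.≡-dec _≟ᶠ_ _≟ᶠ_ (w , z) (v , u)
  ... | yes refl | _        = inj₁ id
  ... | no _     | yes refl = inj₂ (inj₂ (shore-complement uv))
  ... | no β≢α   | no β≢ᾱ   = by-sides (shore-total uv w) (shore-total wz u)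
    where
      by-sides : Shore (u , v) w ⊎ Shore (v , u) w → Shore (w , z) u ⊎ Shore (z , w) u →
                 (u , v) ⊑ (w , z) ⊎ (w , z) ⊑ (u , v) ⊎ ∁ (Shore (u , v)) ⊆ Shore (w , z)
      by-sides (inj₁ cw) (inj₁ cu) =
        inj₂ (inj₂ (shore-⊆ cu (shore-disjoint cz) ∘ shore-complement uv))
        where cz = shore-step wz cw λ { refl → β≢ᾱ refl }
      by-sides (inj₁ cw) (inj₂ cu) = inj₂ (inj₁ (shore-⊆ cz λ c → shore-disjoint c cv))
        where cz = shore-step wz cw λ { refl → β≢ᾱ refl }
              cv = shore-step uv cu λ { refl → β≢α refl }
      by-sides (inj₂ cw) (inj₁ cu) = inj₁ (shore-⊆ cv λ c → shore-disjoint c cz)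
        where cz = shore-step wz cw λ { refl → β≢α refl }
              cv = shore-step uv cu λ { refl → β≢ᾱ refl }
      by-sides (inj₂ cw) (inj₂ cu) = ⊥-elim (shore-disjoint xα (shore-⊆ cz (λ c → shore-disjoint c cu) xβ))
        where cz = shore-step wz cw λ { refl → β≢α refl }
              xα = proj₁ (proj₂ meet)
              xβ = proj₂ (proj₂ meet)

  end-leaf : ∀ {c p q} → Path (c ∷ p ∷ q) → (∀ d → Adj c d → d ∈ c ∷ p ∷ q) → IsLeaf T c
  end-leaf {c} {p} P closed = p , Linked.head (proj₁ P) , neighbours
    where
      neighbours : ∀ d → Adj c d → d ≡ p
      neighbours d cd with closed d cd
      ... | here refl = contradiction refl (adj⇒≢ cd)
      ... | there d∈  = sym (shore-neighbour cd (shore-prefix _ P d∈))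

  -- Extends the path at its head away from α until the head is a leaf; the path has
  -- distinct vertices, so its length never exceeds n and n steps of fuel suffice.
  leaf-in-shore-from : ∀ fuel {α c p q} → Path (c ∷ p ∷ q) → n < fuel + length (c ∷ p ∷ q) →
                       proj₁ α ∈ p ∷ q → Shore α c → ∃[ l ] (IsLeaf T l × Shore α l)
  leaf-in-shore-from zero P fuel-bound _ _ =
    contradiction (<-≤-trans fuel-bound (unique-length≤ (proj₂ P))) (<-irrefl refl)
  leaf-in-shore-from (suc fuel) {c = c} {p} {q} P fuel-bound u∈ cc
    with any? (λ d → (adj c d Bool.≟ true) ×-dec ¬? (d ∈? (c ∷ p ∷ q)))
  ... | yes (d , cd , d∉) =
    leaf-in-shore-from fuel (path-∷ (adj-sym′ cd) d∉ P)
      (subst (n <_) (sym (+-suc fuel _)) fuel-bound) (there u∈)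
      (shore-step cd cc λ { refl → d∉ (there u∈) })
  ... | no stuck = c , end-leaf P (λ d cd → decidable-stable (d ∈? _) λ d∉ → stuck (d , cd , d∉)) , cc

  leaf-in-shore : ∀ {α} → IsEdge α → ∃[ l ] (IsLeaf T l × Shore α l)
  leaf-in-shore {u , v} uv =
    leaf-in-shore-from n (edge-path (adj-sym′ uv)) (m<m+n n z<s) (here refl) (_ , edge-path uv , refl , refl)

  Stabbed : List (Arc T) → V T → V T → Set
  Stabbed S a b = ∀ {α} → α ∈ S → Shore α a ⊎ Shore α b

  TwoOfThreeMeet : List (Arc T) → Set
  TwoOfThreeMeet S = ∀ {α β γ} → α ∈ S → β ∈ S → γ ∈ S →
                     Shore α ≬ Shore β ⊎ Shore β ≬ Shore γ ⊎ Shore α ≬ Shore γ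

  stab-if-meets-minimal : ∀ {S m β a b} → IsEdge m → IsEdge β → β ∈ S → Minimal _⊑_ S m →
                          Shore m ≬ Shore β → Shore m a → ¬ Shore m b → Shore β a ⊎ Shore β b
  stab-if-meets-minimal em eβ β∈ m-min meet am ¬bm with meeting-shores em eβ meet
  ... | inj₁ m⊑β        = inj₁ (m⊑β am)
  ... | inj₂ (inj₁ β⊑m) = inj₁ (m-min β∈ β⊑m am)
  ... | inj₂ (inj₂ ∁m⊆β) = inj₂ (∁m⊆β ¬bm)

  TwoLeavesStab : List (Arc T) → Set
  TwoLeavesStab S = ∃[ a ] ∃[ b ] (IsLeaf T a × IsLeaf T b × a ≢ b × Stabbed S a b)

  stab-if-all-meet-minimal : ∀ {S m} → All IsEdge S → m ∈ S → Minimal _⊑_ S m →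
                             All (λ β → Shore m ≬ Shore β) S → TwoLeavesStab S
  stab-if-all-meet-minimal {m = m} edges m∈ m-min meets
    with a , la , am ← leaf-in-shore (All.lookup edges m∈)
       | b , lb , bm̄ ← leaf-in-shore {swap m} (adj-sym′ (All.lookup edges m∈)) =
    a , b , la , lb , (λ { refl → shore-disjoint am bm̄ }) ,
    λ β∈ → stab-if-meets-minimal (All.lookup edges m∈) (All.lookup edges β∈) β∈ m-min
             (All.lookup meets β∈) am λ bm → shore-disjoint bm bm̄

  stab-by-disjoint-minimals : ∀ {S m₁ m₂} → All IsEdge S → TwoOfThreeMeet S → m₁ ∈ S → m₂ ∈ S →
                              Minimal _⊑_ S m₁ → Minimal _⊑_ S m₂ → ¬ Shore m₁ ≬ Shore m₂ →
                              TwoLeavesStab S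
  stab-by-disjoint-minimals {S} {m₁} {m₂} edges three m₁∈ m₂∈ min₁ min₂ apart
    with a , la , am₁ ← leaf-in-shore (All.lookup edges m₁∈)
       | b , lb , bm₂ ← leaf-in-shore (All.lookup edges m₂∈) =
    a , b , la , lb , (λ { refl → apart (a , am₁ , bm₂) }) , stab
    where
      stab : Stabbed S a b
      stab {β} β∈ with m₁ ≬? β | m₂ ≬? β
      ... | yes meet₁ | _ = stab-if-meets-minimal (All.lookup edges m₁∈) (All.lookup edges β∈) β∈ min₁ meet₁
                              am₁ λ bm₁ → apart (b , bm₁ , bm₂)
      ... | no _ | yes meet₂ = Sum.swap (stab-if-meets-minimal (All.lookup edges m₂∈) (All.lookup edges β∈) β∈
                                 min₂ meet₂ bm₂ λ am₂ → apart (a , am₁ , am₂))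
      ... | no ¬meet₁ | no ¬meet₂ = ⊥-elim ([ apart , [ ¬meet₂ , ¬meet₁ ]′ ]′ (three m₁∈ m₂∈ β∈))

  stab-if-some-avoid-minimal : ∀ {S m₁ β₀} → All IsEdge S → TwoOfThreeMeet S → m₁ ∈ S →
                               Minimal _⊑_ S m₁ → β₀ ∈ S → ¬ Shore m₁ ≬ Shore β₀ → TwoLeavesStab S
  stab-if-some-avoid-minimal {S} {m₁} edges three m₁∈ min₁ β₀∈ β₀-avoids =
    stab-by-disjoint-minimals edges three m₁∈ m₂∈ min₁ min₂ m₂-avoids
    where
      avoids? : Relation.Unary.Decidable (λ β → ¬ Shore m₁ ≬ Shore β)
      avoids? β = ¬? (m₁ ≬? β)
      minimal-avoider = minimal-∈ ⊑-trans _⊑?_ (filter avoids? S) (∈-filter⁺ avoids? β₀∈ β₀-avoids)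
      m₂ = proj₁ minimal-avoider
      m₂∈ = proj₁ (∈-filter⁻ avoids? {xs = S} (proj₁ (proj₂ minimal-avoider)))
      m₂-avoids = proj₂ (∈-filter⁻ avoids? {xs = S} (proj₁ (proj₂ minimal-avoider)))
      min₂ : Minimal _⊑_ S m₂
      min₂ γ∈ γ⊑m₂ = proj₂ (proj₂ minimal-avoider)
        (∈-filter⁺ avoids? γ∈ λ { (x , c₁ , cγ) → m₂-avoids (x , c₁ , γ⊑m₂ cγ) }) γ⊑m₂

  two-leaves-stab : ∀ {S α} → α ∈ S → All IsEdge S → TwoOfThreeMeet S → TwoLeavesStab S
  two-leaves-stab {S} α∈ edges three
    with minimal-∈ ⊑-trans _⊑?_ S α∈
  ... | m₁ , m₁∈ , min₁ with All.all? (m₁ ≬?_) S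
  ... | yes meets = stab-if-all-meet-minimal edges m₁∈ min₁ meets
  ... | no ¬meets with β₀ , β₀∈ , β₀-avoids ← find (¬All⇒Any¬ (m₁ ≬?_) S ¬meets) =
    stab-if-some-avoid-minimal edges three m₁∈ min₁ β₀∈ β₀-avoids

  last-arc : ∀ x y rest → ∃[ ρ ] (last (arcs T (x ∷ y ∷ rest)) ≡ just ρ)
  last-arc x y []         = (x , y) , refl
  last-arc x y (z ∷ rest) = last-arc y z rest

  request-arcs : ∀ {r} → IsRequest T r → ∃[ ε ] ∃[ ρ ] (emission T r ≡ just ε × reception T r ≡ just ρ)
  request-arcs {x ∷ []} (_ , s≤s ())
  request-arcs {x ∷ y ∷ rest} _ = (x , y) , proj₁ (last-arc x y rest) , refl , proj₂ (last-arc x y rest)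

  emissions-meet-on : ∀ {r r′ ε ε′} → IsRequest T r′ → InterferesOn T r r′ →
                      emission T r ≡ just ε → emission T r′ ≡ just ε′ → Shore ε ≬ Shore ε′
  emissions-meet-on {r′ = r′} req′ (P , p , hP , lP) eε eε′ with _ , (_ , t) , _ , eρ ← request-arcs req′ =
    t , (P , p , trans hP eε , arcs-last P (trans lP eρ)) , (r′ , proj₁ req′ , eε′ , arcs-last r′ eρ)

  receptions-meet-on : ∀ {r r′ ρ ρ′} → IsRequest T r → InterferesOn T r r′ →
                       reception T r ≡ just ρ → reception T r′ ≡ just ρ′ → Shore (swap ρ) ≬ Shore (swap ρ′)
  receptions-meet-on req (P , p , hP , lP) eρ eρ′ with (s , _) , _ , eε , _ ← request-arcs req =
    s , shore-∋-path-start (proj₁ req) (arcs-head eε) eρ ,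
        shore-∋-path-start p (arcs-head (trans hP eε)) (trans lP eρ′)

  clique-interfere : ∀ {R W r r′} → IsClique T R W → r ∈ W → r′ ∈ W → Path r → Interfere T r r′
  clique-interfere {r = r} {r′} (_ , interfere) r∈ r′∈ pr with List.≡-dec _≟ᶠ_ r r′
  ... | yes refl  = inj₁ (r , pr , refl , refl)  -- a request interferes on itself
  ... | no r≢r′ = interfere r r′ r∈ r′∈ r≢r′

  endArcs : List (V T) → List (Arc T)
  endArcs r = fromMaybe (emission T r) ++ fromMaybe (Maybe.map swap (reception T r))

  arcFamily : List (List (V T)) → List (Arc T)
  arcFamily = concatMap endArcs

  EmissionIn ReceptionIn : List (List (V T)) → Arc T → Set
  EmissionIn  W α = ∃[ r ] (r ∈ W × emission T r ≡ just α)
  ReceptionIn W α = ∃[ r ] (r ∈ W × reception T r ≡ just (swap α))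

  ∈-arcFamily⁻ : ∀ {W α} → α ∈ arcFamily W → EmissionIn W α ⊎ ReceptionIn W α
  ∈-arcFamily⁻ {W} α∈ with r , r∈ , α∈r ← find (∈-concatMap⁻ endArcs {xs = W} α∈)
    with ∈-++⁻ (fromMaybe (emission T r)) α∈r
  ... | inj₁ α∈ε = inj₁ (r , r∈ , ∈-fromMaybe⁻ α∈ε)
  ... | inj₂ α∈ρ = inj₂ (r , r∈ , map-swap-just⁻ (∈-fromMaybe⁻ α∈ρ))

  emission-∈-arcFamily : ∀ {W r ε} → r ∈ W → emission T r ≡ just ε → ε ∈ arcFamily W
  emission-∈-arcFamily {ε = ε} r∈ eε =
    ∈-concatMap⁺ endArcs (lose {P = λ r → ε ∈ endArcs r} r∈ (∈-++⁺ˡ (∈-fromMaybe⁺ eε)))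

  reception-∈-arcFamily : ∀ {W r ρ} → r ∈ W → reception T r ≡ just ρ → swap ρ ∈ arcFamily W
  reception-∈-arcFamily {ρ = ρ} r∈ eρ =
    ∈-concatMap⁺ endArcs (lose {P = λ r → swap ρ ∈ endArcs r} r∈
      (∈-++⁺ʳ (fromMaybe (emission T _)) (∈-fromMaybe⁺ (cong (Maybe.map swap) eρ))))

  module _ {R W} (requests : All (IsRequest T) R) (clique : IsClique T R W) where

    request : ∀ {r} → r ∈ W → IsRequest T r
    request r∈ = All.lookup requests (All.lookup (proj₁ clique) r∈)

    emissions-meet : ∀ {α β} → EmissionIn W α → EmissionIn W β → Shore α ≬ Shore β
    emissions-meet (r , r∈ , eα) (r′ , r′∈ , eβ) with clique-interfere clique r∈ r′∈ (proj₁ (request r∈))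
    ... | inj₁ r↝r′ = emissions-meet-on (request r′∈) r↝r′ eα eβ
    ... | inj₂ r′↝r = ≬-sym (emissions-meet-on (request r∈) r′↝r eβ eα)

    receptions-meet : ∀ {α β} → ReceptionIn W α → ReceptionIn W β → Shore α ≬ Shore β
    receptions-meet {α} {β} (r , r∈ , eα) (r′ , r′∈ , eβ) with clique-interfere clique r∈ r′∈ (proj₁ (request r∈))
    ... | inj₁ r↝r′ = receptions-meet-on {r′ = r′} {swap α} {swap β} (request r∈) r↝r′ eα eβ
    ... | inj₂ r′↝r = ≬-sym (receptions-meet-on {r′ = r} {swap β} {swap α} (request r′∈) r′↝r eβ eα)

    arcFamily-edges : All IsEdge (arcFamily W)
    arcFamily-edges = All.tabulate λ α∈ → [ emission-edge , reception-edge ]′ (∈-arcFamily⁻ α∈)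
      where
        emission-edge : ∀ {α} → EmissionIn W α → IsEdge α
        emission-edge (r , r∈ , eα) = arcs-edge (proj₁ (proj₁ (request r∈))) (head-∈ eα)
        reception-edge : ∀ {α} → ReceptionIn W α → IsEdge α
        reception-edge (r , r∈ , eα) = adj-sym′ (arcs-edge (proj₁ (proj₁ (request r∈))) (last-∈ eα))

    arcFamily-two-of-three-meet : TwoOfThreeMeet (arcFamily W)
    arcFamily-two-of-three-meet α∈ β∈ γ∈ =
      two-kinds-pigeonhole {_~_ = λ α β → Shore α ≬ Shore β} emissions-meet receptions-meet
        (∈-arcFamily⁻ α∈) (∈-arcFamily⁻ β∈) (∈-arcFamily⁻ γ∈)

  unimodal-between : ∀ {r x ε ρ} → emission T r ≡ just ε → reception T r ≡ just ρ →
                     Shore ε x → Shore (swap ρ) x → Unimodal T x r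
  unimodal-between eε eρ xε xρ̄ =
    (λ converging → shore-disjoint (All.lookup converging (last-∈ eρ)) xρ̄) ,
    (λ diverging → All.lookup diverging (head-∈ eε) xε)

  arcEnds : Maybe (Arc T) → List (V T)
  arcEnds nothing        = []
  arcEnds (just (p , q)) = p ∷ q ∷ []

  endVertices : List (V T) → List (V T)
  endVertices r = arcEnds (emission T r) ++ arcEnds (reception T r)

  terminals : List (List (V T)) → List (V T)
  terminals = concatMap endVertices

  candidates : List (List (V T)) → List (List (V T) × V T)
  candidates R = cartesianProductWith (λ a b → pathBetween a b , b) (terminals R) (terminals R)

  ∈-arcEnds : ∀ {m p q} → m ≡ just (p , q) → p ∈ arcEnds m × q ∈ arcEnds m
  ∈-arcEnds refl = here refl , there (here refl)

  leaf-∈-terminals : ∀ {R a} → Covered T R → IsLeaf T a → a ∈ terminals R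
  leaf-∈-terminals {R} {a} covered (u , au , _) with covered a u au
  ... | r , r∈ , arc-at-a =
    ∈-concatMap⁺ endVertices (lose {P = λ r → a ∈ endVertices r} r∈ (a∈ arc-at-a))
    where
      a∈ : ∀ {r} → emission T r ≡ just (a , u) ⊎ emission T r ≡ just (u , a) ⊎
                   reception T r ≡ just (a , u) ⊎ reception T r ≡ just (u , a) → a ∈ endVertices r
      a∈ (inj₁ e)                   = ∈-++⁺ˡ (proj₁ (∈-arcEnds e))
      a∈ (inj₂ (inj₁ e))            = ∈-++⁺ˡ (proj₂ (∈-arcEnds e))
      a∈ {r} (inj₂ (inj₂ (inj₁ e))) = ∈-++⁺ʳ (arcEnds (emission T r)) (proj₁ (∈-arcEnds e))
      a∈ {r} (inj₂ (inj₂ (inj₂ e))) = ∈-++⁺ʳ (arcEnds (emission T r)) (proj₂ (∈-arcEnds e))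

  candidates-length : ∀ R → length (candidates R) ≤ 16 * length R ^ 2
  candidates-length R = begin
    length (candidates R)                       ≡⟨ length-cartesianProductWith _ (terminals R) (terminals R) ⟩
    length (terminals R) * length (terminals R) ≤⟨ *-mono-≤ terminals-length terminals-length ⟩
    (4 * length R) * (4 * length R)             ≡⟨ square-4* (length R) ⟩
    16 * length R ^ 2                           ∎
    where
      open ≤-Reasoning
      arcEnds-length : ∀ m → length (arcEnds m) ≤ 2
      arcEnds-length nothing  = z≤n
      arcEnds-length (just _) = ≤-refl
      endVertices-length : ∀ r → length (endVertices r) ≤ 4
      endVertices-length r = begin
        length (endVertices r)                                           ≡⟨ length-++ (arcEnds ε) ⟩
        length (arcEnds ε) + length (arcEnds ρ) ≤⟨ +-mono-≤ (arcEnds-length ε) (arcEnds-length ρ) ⟩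
        4                                                                ∎
        where ε = emission T r
              ρ = reception T r
      terminals-length : length (terminals R) ≤ 4 * length R
      terminals-length = length-concatMap≤ endVertices endVertices-length R
      -- k ^ 2 unfolds to k * (k * 1)
      square-4* : ∀ k → (4 * k) * (4 * k) ≡ 16 * (k * (k * 1))
      square-4* = solve-∀

  bough-between : ∀ {a b} → IsLeaf T a → IsLeaf T b → a ≢ b → IsBough T (pathBetween a b)
  bough-between {a} {b} la lb a≢b =
    pathBetween-isPath a b , a , b , head-pathBetween a b , last-pathBetween a b , a≢b , la , lb

  shore-at-bough-end : ∀ {S a b α} → Stabbed S a b → α ∈ S → swap α ∉ arcs T (pathBetween a b) →
                       Shore α b
  shore-at-bough-end {a = a} {b} stab α∈ ᾱ∉ with stab α∈
  ... | inj₁ aα =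
    shore-along (proj₁ (pathBetween-isPath a b)) (head-pathBetween a b) (last-pathBetween a b) ᾱ∉ aα
  ... | inj₂ bα = bα

  unimodal-off-bough : ∀ {W a b r} → Stabbed (arcFamily W) a b → r ∈ W → IsRequest T r →
                       SharesNoArc T r (pathBetween a b) → Unimodal T b r
  unimodal-off-bough {W} stab r∈ req disjoint with (s , s′) , (t′ , t) , eε , eρ ← request-arcs req =
    unimodal-between eε eρ
      (shore-at-bough-end stab (emission-∈-arcFamily {W} r∈ eε) (proj₂ (disjoint s s′ (head-∈ eε))))
      (shore-at-bough-end stab (reception-∈-arcFamily {W} r∈ eρ) (proj₁ (disjoint t′ t (last-∈ eρ))))

  clique-bough : ∀ {R} → All (IsRequest T) R → Covered T R →
    (W : List (List (V T))) → IsClique T R W → W ≢ [] →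
    ∃[ Q ] ∃[ x ] ((Q , x) ∈ candidates R × IsBough T Q × x ∈ Q ×
      (∀ r → r ∈ W → SharesNoArc T r Q → Unimodal T x r))
  clique-bough requests covered [] _ W≢[] = contradiction refl W≢[]
  clique-bough requests covered W@(_ ∷ _) clique _
    with request-arcs (request requests clique (here refl))
  ... | _ , _ , eε₀ , _
    with two-leaves-stab (emission-∈-arcFamily {W} (here refl) eε₀)
           (arcFamily-edges requests clique) (arcFamily-two-of-three-meet requests clique)
  ... | a , b , la , lb , a≢b , stab =
    pathBetween a b , b ,
    ∈-cartesianProductWith⁺ _ (leaf-∈-terminals covered la) (leaf-∈-terminals covered lb) ,
    bough-between la lb a≢b , last-∈ (last-pathBetween a b) ,
    λ r r∈ → unimodal-off-bough stab r∈ (request requests clique r∈)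

lemma10 : ∃[ c ] ((T : Tree) → (R : List (List (V T))) →
          All (IsRequest T) R → Unique R → Covered T R →
          ∃[ L ] (length L ≤ c * length R ^ 2 ×
            ((W : List (List (V T))) → IsClique T R W → W ≢ [] →
              ∃[ Q ] ∃[ x ] ((Q , x) ∈ L × IsBough T Q × x ∈ Q ×
                (∀ r → r ∈ W → SharesNoArc T r Q → Unimodal T x r)))))
lemma10 = 16 , λ T R requests _ covered →
  candidates T R , candidates-length T R , clique-bough T requests covered
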